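{- Let $n,k$ be integers with $2\le k\le n-1$ and $n\le 2k$. Then the number $w_{n,k}$ of vertices of $G(n)$ contained in some closed $k$-walk equals $\dfrac{n!}{(n-k)!}$.
   Context: For a sequence of distinct integers $c_1\cdots c_t$, $\mathrm{st}(c_1\cdots c_t)$ is the unique permutation $d_1\cdots d_t$ of $\{1,\dots,t\}$ with $d_i<d_j$ iff $c_i<c_j$. $G(n)$ is the directed multigraph whose vertices are the permutations of $\{1,\dots,n\}$ (one-line notation) and whose edges are the permutations $c_1\cdots c_{n+1}$ of $\{1,\dots,n+1\}$, the edge $c_1\cdots c_{n+1}$ going from $\mathrm{st}(c_1\cdots c_n)$ to $\mathrm{st}(c_2\cdots c_{n+1})$; so there is an edge from $x_1\cdots x_n$ to $w_1\cdots w_n$ iff $\mathrm{st}(x_2\cdots x_n)=\mathrm{st}(w_1\cdots w_{n-1})$. A closed $k$-walk $(v_1,\dots,v_k)$ is a sequence of vertices with an edge from $v_i$ to $v_{i+1}$ for $i<k$ and from $v_k$ to $v_1$. -}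

module Defs where

open import Data.Nat using (ℕ; zero; suc; _≤?_; _<_; _∸_)
open import Data.List using (List; map; filter; length; upTo; take; drop)
open import Data.List.Relation.Binary.Permutation.Propositional using (_↭_)
open import Data.Product using (Σ; ∃; _×_)
open import Relation.Binary.PropositionalEquality using (_≡_)

IsPerm : ℕ → List ℕ → Set
IsPerm n xs = xs ↭ map suc (upTo n)

-- Standardization st(c₁⋯c_t): the i-th entry is the rank of cᵢ,
-- i.e. #{ j | c_j ≤ cᵢ }.  For distinct entries this is the unique
-- permutation d of {1,…,t} with dᵢ < dⱼ ⇔ cᵢ < cⱼ.
st : List ℕ → List ℕ
st c = map (λ x → length (filter (_≤? x) c)) c

-- Since only the existence of an
-- edge matters for walks, we record "there is at least one edge".
Edge : ℕ → List ℕ → List ℕ → Set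
Edge n x w = ∃ λ c → IsPerm (suc n) c × st (take n c) ≡ x × st (drop 1 c) ≡ w

-- A closed k-walk (v₀,…,v_{k-1}) in G(n), given as v : ℕ → List ℕ
-- (only indices < k matter): all vᵢ are vertices, consecutive ones are
-- joined by edges, and v_{k-1} → v₀.
ClosedWalk : ℕ → ℕ → (ℕ → List ℕ) → Set
ClosedWalk n k v =
  (∀ i → i < k → IsPerm n (v i)) ×
  (∀ i → suc i < k → Edge n (v i) (v (suc i))) ×
  Edge n (v (k ∸ 1)) (v 0)

OnClosedWalk : ℕ → ℕ → List ℕ → Set
OnClosedWalk n k x = ∃ λ v → ClosedWalk n k v × ∃ λ i → i < k × v i ≡ x

module Submission where

-- A vertex x of G(n) lies on a closed k-walk iff its first n − k entries have the same pattern
-- as its last n − k entries. Along an edge, the last n − 1 entries of a vertex have the pattern of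
-- the first n − 1 entries of the next one; after the k steps of a closed walk this gives the
-- condition. Conversely, the length-n windows of a duplicate-free sequence of length n + k form a
-- k-walk, so it suffices to extend x to such a sequence whose first and last windows both
-- standardize to x: take N·x₁, …, N·xₙ (N = n + 1) followed by ψ(x_{n−k+1}), …, ψ(xₙ), where ψ
-- is strictly increasing on {1,…,n}, sends the i-th of the first n − k entries of x to N times the
-- i-th of the last n − k, and sends every other value strictly between two multiples of N.
-- Finally, as n − k ≤ k, such an x is determined by its first k entries, which can be any k
-- distinct values: the other entries are the unused values, arranged in the pattern of the first
-- n − k.

open import Defs
open import Data.Nat
  using (ℕ; zero; suc; pred; _≤_; _<_; _≰_; _*_; _+_; _∸_; _/_; _%_; _!; _≤?_; _≟_; z≤n; s≤s; s≤s⁻¹; _⊓_)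
open import Data.Nat.Properties
open import Data.Nat.DivMod using (m*n%n≡0; [m+kn]%n≡m%n; m<n⇒m%n≡m)
open import Data.Nat.Combinatorics.Base using (_P′_)
open import Data.Nat.Combinatorics.Specification using (nP′k≡n!/[n∸k]!; nP′k≡n[n∸1P′k∸1])
open import Data.List using (List; []; _∷_; [_]; _++_; length; map; filter; take; drop; upTo; zip; concatMap)
import Data.List.Properties as List
open import Data.List.Extrema.Nat using (min; max; min≤⊤; min≤xs; argmin-sel; max≈v⁺; max<v⁺; max-mono-⊆)
open import Data.List.Membership.Propositional using (_∈_; _∉_; lose; find)
open import Data.List.Membership.Propositional.Properties
  using (∈-map⁺; ∈-map⁻; ∈-++⁺ˡ; ∈-++⁺ʳ; ∈-filter⁺; ∈-filter⁻; ∈-upTo⁻; ∈-∃++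
        ; ∈-concatMap⁺; ∈-concatMap⁻)
open import Data.List.Membership.DecPropositional _≟_ using (_∈?_)
open import Data.List.Relation.Unary.Any using (here; there)
open import Data.List.Relation.Unary.All as All using (All; []; _∷_)
import Data.List.Relation.Unary.All.Properties as All
import Data.List.Relation.Unary.AllPairs as AllPairs
import Data.List.Relation.Unary.AllPairs.Properties as AllPairs
open import Data.List.Relation.Unary.Unique.Propositional using (Unique; []; _∷_)
import Data.List.Relation.Unary.Unique.Propositional.Properties as Unique
open import Data.List.Relation.Binary.Disjoint.Propositional using (Disjoint)
open import Data.List.Relation.Binary.Permutation.Propositional
  using (_↭_; prep; swap; ↭-refl; ↭-sym; ↭-trans; ↭-reflexive; ↭⇒↭ₛ; module PermutationReasoning)
import Data.List.Relation.Binary.Permutation.Propositional.Properties as ↭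
import Data.List.Relation.Binary.Permutation.Setoid.Properties as ↭ₛ
open import Data.Product using (Σ; _×_; _,_; proj₁; proj₂)
open import Data.Sum using (inj₁; inj₂)
open import Data.Empty using (⊥-elim)
open import Function using (_∘_; id)
open import Function.Bundles using (_⇔_; mk⇔; Equivalence)
open import Relation.Nullary using (Dec; yes; no)
open import Relation.Binary.Definitions using (DecidableEquality)
open import Relation.Binary.PropositionalEquality
  using (_≡_; _≢_; refl; sym; trans; cong; cong₂; subst; setoid; module ≡-Reasoning)

open Equivalence using (to; from)

private
  variable
    A : Set

∈-take⁻ : ∀ j {l : List A} {v} → v ∈ take j l → v ∈ l
∈-take⁻ j {l} v∈ = subst (_ ∈_) (List.take++drop≡id j l) (∈-++⁺ˡ v∈)

∈-drop⁻ : ∀ j {l : List A} {v} → v ∈ drop j l → v ∈ l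
∈-drop⁻ j {l} v∈ = subst (_ ∈_) (List.take++drop≡id j l) (∈-++⁺ʳ (take j l) v∈)

drop-take : ∀ j m (l : List A) → drop j (take m l) ≡ take (m ∸ j) (drop j l)
drop-take zero m l = refl
drop-take (suc j) zero l = refl
drop-take (suc j) (suc m) [] = sym (List.take-[] (m ∸ j))
drop-take (suc j) (suc m) (x ∷ l) = drop-take j m l

take-length-++ : ∀ (xs : List A) {ys} → take (length xs) (xs ++ ys) ≡ xs
take-length-++ [] = refl
take-length-++ (x ∷ xs) = cong (x ∷_) (take-length-++ xs)

drop-++-≤ : ∀ {j} (xs : List A) {ys} → j ≤ length xs → drop j (xs ++ ys) ≡ drop j xs ++ ys
drop-++-≤ {j = zero} xs _ = refl
drop-++-≤ {j = suc j} (x ∷ xs) (s≤s j≤) = drop-++-≤ xs j≤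

length-take-≤ : ∀ j {l : List A} → j ≤ length l → length (take j l) ≡ j
length-take-≤ j {l} j≤ = trans (List.length-take j l) (m≤n⇒m⊓n≡m j≤)

map-proj₁-zip : ∀ {B : Set} (xs : List A) (ys : List B) → length xs ≡ length ys → map proj₁ (zip xs ys) ≡ xs
map-proj₁-zip [] [] _ = refl
map-proj₁-zip (x ∷ xs) (y ∷ ys) e = cong (x ∷_) (map-proj₁-zip xs ys (suc-injective e))

map-proj₂-zip : ∀ {B : Set} (xs : List A) (ys : List B) → length xs ≡ length ys → map proj₂ (zip xs ys) ≡ ys
map-proj₂-zip [] [] _ = refl
map-proj₂-zip (x ∷ xs) (y ∷ ys) e = cong (y ∷_) (map-proj₂-zip xs ys (suc-injective e))

map-cong-local⁻ : ∀ {B : Set} {f g : A → B} {l} → map f l ≡ map g l → ∀ {x} → x ∈ l → f x ≡ g x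
map-cong-local⁻ {l = y ∷ l} e (here refl) = proj₁ (List.∷-injective e)
map-cong-local⁻ {l = y ∷ l} e (there x∈) = map-cong-local⁻ (proj₂ (List.∷-injective e)) x∈

length-concatMap-const : ∀ {B : Set} (f : A → List B) l {c} →
  (∀ {v} → v ∈ l → length (f v) ≡ c) → length (concatMap f l) ≡ length l * c
length-concatMap-const f [] h = refl
length-concatMap-const f (v ∷ l) h =
  trans (List.length-++ (f v)) (cong₂ _+_ (h (here refl)) (length-concatMap-const f l (h ∘ there)))

Unique-resp-↭ : ∀ {xs ys : List A} → xs ↭ ys → Unique xs → Unique ys
Unique-resp-↭ p = ↭ₛ.Unique-resp-↭ (setoid _) (↭⇒↭ₛ p)

Unique-++⁻ : ∀ (xs : List A) {ys} → Unique (xs ++ ys) → Unique xs × Unique ys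
Unique-++⁻ [] u = [] , u
Unique-++⁻ (x ∷ xs) (x∉ ∷ u) =
  (All.tabulate (All.lookup x∉ ∘ ∈-++⁺ˡ) ∷ proj₁ (Unique-++⁻ xs u)) , proj₂ (Unique-++⁻ xs u)

Unique⇒take-drop-disjoint : ∀ j {l : List A} → Unique l → Disjoint (take j l) (drop j l)
Unique⇒take-drop-disjoint (suc j) {x ∷ l} (x∉ ∷ u) (here refl , v∈) = All.lookup x∉ (∈-drop⁻ j v∈) refl
Unique⇒take-drop-disjoint (suc j) {x ∷ l} (_ ∷ u) (there v∈ , v∈′) = Unique⇒take-drop-disjoint j u (v∈ , v∈′)

Unique-map⁺-local : ∀ {B : Set} {f : A → B} {l} →
  (∀ {u v} → u ∈ l → v ∈ l → f u ≡ f v → u ≡ v) → Unique l → Unique (map f l)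
Unique-map⁺-local inj [] = []
Unique-map⁺-local inj (x∉ ∷ u) =
  All.map⁺ (All.tabulate λ v∈ e → All.lookup x∉ v∈ (inj (here refl) (there v∈) e))
  ∷ Unique-map⁺-local (λ u∈ v∈ → inj (there u∈) (there v∈)) u

-- Ranks and standardization

StrictlyMonotoneOn : List ℕ → (ℕ → ℕ) → Set
StrictlyMonotoneOn l f = ∀ {u v} → u ∈ l → v ∈ l → u < v → f u < f v

module _ {l f} (mono : StrictlyMonotoneOn l f) where

  strictMono⇒≤⇔ : ∀ {u v} → u ∈ l → v ∈ l → u ≤ v ⇔ f u ≤ f v
  strictMono⇒≤⇔ {u} {v} u∈ v∈ = mk⇔ preserves reflects
    where
    preserves : u ≤ v → f u ≤ f v
    preserves u≤v with m≤n⇒m<n∨m≡n u≤v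
    ... | inj₁ u<v = <⇒≤ (mono u∈ v∈ u<v)
    ... | inj₂ refl = ≤-refl
    reflects : f u ≤ f v → u ≤ v
    reflects fu≤fv = ≮⇒≥ (λ v<u → <⇒≱ (mono v∈ u∈ v<u) fu≤fv)

  strictMono⇒injective : ∀ {u v} → u ∈ l → v ∈ l → f u ≡ f v → u ≡ v
  strictMono⇒injective u∈ v∈ e =
    ≤-antisym (from (strictMono⇒≤⇔ u∈ v∈) (≤-reflexive e))
              (from (strictMono⇒≤⇔ v∈ u∈) (≤-reflexive (sym e)))

rank : List ℕ → ℕ → ℕ
rank l v = length (filter (_≤? v) l)

rank-∷-≤ : ∀ {y} l {v} → y ≤ v → rank (y ∷ l) v ≡ suc (rank l v)
rank-∷-≤ l {v} y≤v = cong length (List.filter-accept (_≤? v) y≤v)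

rank-∷-≰ : ∀ {y} l {v} → y ≰ v → rank (y ∷ l) v ≡ rank l v
rank-∷-≰ l {v} y≰v = cong length (List.filter-reject (_≤? v) y≰v)

rank-resp-↭ : ∀ {l l′} v → l ↭ l′ → rank l v ≡ rank l′ v
rank-resp-↭ v p = ↭.↭-length (↭.filter-↭ (_≤? v) p)

rank-mono-≤ : ∀ l {u v} → u ≤ v → rank l u ≤ rank l v
rank-mono-≤ [] u≤v = z≤n
rank-mono-≤ (y ∷ l) {u} {v} u≤v with y ≤? u | y ≤? v
... | yes y≤u | yes y≤v rewrite rank-∷-≤ l y≤u | rank-∷-≤ l y≤v = s≤s (rank-mono-≤ l u≤v)
... | yes y≤u | no y≰v = ⊥-elim (y≰v (≤-trans y≤u u≤v))
... | no y≰u | yes y≤v rewrite rank-∷-≰ l y≰u | rank-∷-≤ l y≤v = m≤n⇒m≤1+n (rank-mono-≤ l u≤v)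
... | no y≰u | no y≰v rewrite rank-∷-≰ l y≰u | rank-∷-≰ l y≰v = rank-mono-≤ l u≤v

rank-mono-< : ∀ l {u v} → v ∈ l → u < v → rank l u < rank l v
rank-mono-< l {u} {v} v∈ u<v with ys , zs , refl ← ∈-∃++ v∈ = begin-strict
  rank l u         ≡⟨ rank-resp-↭ u l↭v∷l′ ⟩
  rank (v ∷ l′) u  ≡⟨ rank-∷-≰ l′ (<⇒≱ u<v) ⟩
  rank l′ u        ≤⟨ rank-mono-≤ l′ (<⇒≤ u<v) ⟩
  rank l′ v        <⟨ n<1+n (rank l′ v) ⟩
  suc (rank l′ v)  ≡⟨ rank-∷-≤ l′ ≤-refl ⟨
  rank (v ∷ l′) v  ≡⟨ rank-resp-↭ v l↭v∷l′ ⟨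
  rank l v         ∎
  where
  open ≤-Reasoning
  l′ : List ℕ
  l′ = ys ++ zs
  l↭v∷l′ : l ↭ v ∷ l′
  l↭v∷l′ = ↭.shift v ys zs

rank-strictMono : ∀ {l l′} → (∀ {v} → v ∈ l′ → v ∈ l) → StrictlyMonotoneOn l′ (rank l)
rank-strictMono l′⊆l _ v∈ = rank-mono-< _ (l′⊆l v∈)

rank-map : ∀ f l {a} → (∀ {b} → b ∈ l → b ≤ a ⇔ f b ≤ f a) → rank (map f l) (f a) ≡ rank l a
rank-map f [] h = refl
rank-map f (y ∷ l) {a} h with y ≤? a
... | yes y≤a = begin
  rank (map f (y ∷ l)) (f a)  ≡⟨ rank-∷-≤ (map f l) (to (h (here refl)) y≤a) ⟩
  suc (rank (map f l) (f a))  ≡⟨ cong suc (rank-map f l (h ∘ there)) ⟩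
  suc (rank l a)              ≡⟨ rank-∷-≤ l y≤a ⟨
  rank (y ∷ l) a              ∎
  where open ≡-Reasoning
... | no y≰a = begin
  rank (map f (y ∷ l)) (f a)  ≡⟨ rank-∷-≰ (map f l) (y≰a ∘ from (h (here refl))) ⟩
  rank (map f l) (f a)        ≡⟨ rank-map f l (h ∘ there) ⟩
  rank l a                    ≡⟨ rank-∷-≰ l y≰a ⟨
  rank (y ∷ l) a              ∎
  where open ≡-Reasoning

st-map : ∀ {f l} → StrictlyMonotoneOn l f → st (map f l) ≡ st l
st-map {f} {l} mono = begin
  map (rank (map f l)) (map f l)  ≡⟨ List.map-∘ l ⟨
  map (rank (map f l) ∘ f) l      ≡⟨ List.map-cong-local (All.tabulate same-rank) ⟩
  map (rank l) l                  ∎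
  where
  open ≡-Reasoning
  same-rank : ∀ {a} → a ∈ l → rank (map f l) (f a) ≡ rank l a
  same-rank a∈ = rank-map f l λ b∈ → strictMono⇒≤⇔ mono b∈ a∈

st-take : ∀ j l → st (take j (st l)) ≡ st (take j l)
st-take j l = trans (cong st (List.take-map j l)) (st-map (rank-strictMono (∈-take⁻ j)))

st-drop : ∀ j l → st (drop j (st l)) ≡ st (drop j l)
st-drop j l = trans (cong st (List.drop-map j l)) (st-map (rank-strictMono (∈-drop⁻ j)))

st-take-cong : ∀ j {l l′} → st l ≡ st l′ → st (take j l) ≡ st (take j l′)
st-take-cong j {l} {l′} e = trans (sym (st-take j l)) (trans (cong (st ∘ take j) e) (st-take j l′))

st-drop-cong : ∀ j {l l′} → st l ≡ st l′ → st (drop j l) ≡ st (drop j l′)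
st-drop-cong j {l} {l′} e = trans (sym (st-drop j l)) (trans (cong (st ∘ drop j) e) (st-drop j l′))

st-↭ : ∀ {l l′} → l ↭ l′ → st l ↭ st l′
st-↭ {l} {l′} p = ↭-trans (↭.map⁺ (rank l) p) (↭-reflexive (List.map-cong (λ v → rank-resp-↭ v p) l′))

st-≡⇒≤⇔ : ∀ {C : Set} {f g : C → ℕ} {Q} → st (map f Q) ≡ st (map g Q) →
  ∀ {q q′} → q ∈ Q → q′ ∈ Q → f q ≤ f q′ ⇔ g q ≤ g q′
st-≡⇒≤⇔ {f = f} {g} {Q} e {q} {q′} q∈ q′∈ = mk⇔
  (from (≤⇔ranks g) ∘ subst id same-ranks ∘ to (≤⇔ranks f))
  (from (≤⇔ranks f) ∘ subst id (sym same-ranks) ∘ to (≤⇔ranks g))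
  where
  ≤⇔ranks : ∀ h → h q ≤ h q′ ⇔ rank (map h Q) (h q) ≤ rank (map h Q) (h q′)
  ≤⇔ranks h = strictMono⇒≤⇔ (rank-strictMono id) (∈-map⁺ h q∈) (∈-map⁺ h q′∈)
  ranks : ∀ {p} → p ∈ Q → rank (map f Q) (f p) ≡ rank (map g Q) (g p)
  ranks = map-cong-local⁻ (trans (List.map-∘ Q) (trans e (sym (List.map-∘ Q))))
  same-ranks : (rank (map f Q) (f q) ≤ rank (map f Q) (f q′)) ≡ (rank (map g Q) (g q) ≤ rank (map g Q) (g q′))
  same-ranks = cong₂ _≤_ (ranks q∈) (ranks q′∈)

-- Junk value 0 when no element of R has rank r.
unrank : List ℕ → ℕ → ℕ
unrank R r = max 0 (filter (λ v → rank R v ≟ r) R)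

unrank-rank : ∀ {R v} → v ∈ R → unrank R (rank R v) ≡ v
unrank-rank {R} {v} v∈ = max≈v⁺ (∈-filter⁺ (λ u → rank R u ≟ rank R v) v∈ refl) (All.tabulate below) z≤n
  where
  below : ∀ {w} → w ∈ filter (λ u → rank R u ≟ rank R v) R → w ≤ v
  below w∈ with w∈R , e ← ∈-filter⁻ (λ u → rank R u ≟ rank R v) w∈ =
    ≤-reflexive (strictMono⇒injective (rank-strictMono id) w∈R v∈ e)

unrank-strictMono : ∀ R → StrictlyMonotoneOn (st R) (unrank R)
unrank-strictMono R r∈ r′∈ r<r′
  with u , u∈ , refl ← ∈-map⁻ (rank R) r∈ | u′ , u′∈ , refl ← ∈-map⁻ (rank R) r′∈
  rewrite unrank-rank u∈ | unrank-rank u′∈ = ≰⇒> (<⇒≱ r<r′ ∘ rank-mono-≤ R)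

map-unrank-st : ∀ {R l} → l ↭ R → map (unrank R) (st l) ≡ l
map-unrank-st {R} {l} p = begin
  map (unrank R) (map (rank l) l)  ≡⟨ List.map-∘ l ⟨
  map (unrank R ∘ rank l) l        ≡⟨ List.map-cong-local (All.tabulate unrank-rank-↭) ⟩
  map id l                         ≡⟨ List.map-id l ⟩
  l                                ∎
  where
  open ≡-Reasoning
  unrank-rank-↭ : ∀ {v} → v ∈ l → unrank R (rank l v) ≡ v
  unrank-rank-↭ {v} v∈ = trans (cong (unrank R) (rank-resp-↭ v p)) (unrank-rank (↭.∈-resp-↭ p v∈))

map-unrank-↭ : ∀ {R p} → p ↭ st R → map (unrank R) p ↭ R
map-unrank-↭ {R} q = ↭-trans (↭.map⁺ (unrank R) q) (↭-reflexive (map-unrank-st ↭-refl))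

-- Permutations of {1,…,n}

oneTo : ℕ → List ℕ
oneTo n = map suc (upTo n)

length-oneTo : ∀ n → length (oneTo n) ≡ n
length-oneTo n = trans (List.length-map suc (upTo n)) (List.length-upTo n)

oneTo-unique : ∀ n → Unique (oneTo n)
oneTo-unique n = Unique.map⁺ suc-injective (Unique.upTo⁺ n)

oneTo-suc : ∀ n → oneTo (suc n) ≡ 1 ∷ map suc (oneTo n)
oneTo-suc n = cong (λ l → 1 ∷ map suc l) (sym (List.map-upTo suc n))

∈-oneTo⁻ : ∀ {n v} → v ∈ oneTo n → 1 ≤ v × v ≤ n
∈-oneTo⁻ v∈ with i , i∈ , refl ← ∈-map⁻ suc v∈ = s≤s z≤n , ∈-upTo⁻ i∈

rank-oneTo : ∀ n v → rank (oneTo n) v ≡ n ⊓ v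
rank-oneTo zero v = refl
rank-oneTo (suc n) zero =
  cong length (List.filter-none (_≤? 0) (All.tabulate λ v∈ → <⇒≱ (proj₁ (∈-oneTo⁻ {suc n} v∈))))
rank-oneTo (suc n) (suc v) = begin
  rank (oneTo (suc n)) (suc v)           ≡⟨ cong (λ l → rank l (suc v)) (oneTo-suc n) ⟩
  suc (rank (map suc (oneTo n)) (suc v)) ≡⟨ cong suc (rank-map suc (oneTo n) λ _ → mk⇔ s≤s s≤s⁻¹) ⟩
  suc (rank (oneTo n) v)                 ≡⟨ cong suc (rank-oneTo n v) ⟩
  suc (n ⊓ v)                            ∎
  where open ≡-Reasoning

module _ {n x} (x-perm : IsPerm n x) where

  isPerm⇒length : length x ≡ n
  isPerm⇒length = trans (↭.↭-length x-perm) (length-oneTo n)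

  isPerm⇒unique : Unique x
  isPerm⇒unique = Unique-resp-↭ (↭-sym x-perm) (oneTo-unique n)

  ∈-isPerm⁻ : ∀ {v} → v ∈ x → 1 ≤ v × v ≤ n
  ∈-isPerm⁻ v∈ = ∈-oneTo⁻ (↭.∈-resp-↭ x-perm v∈)

  st-isPerm-id : st x ≡ x
  st-isPerm-id = trans (List.map-cong-local (All.tabulate rank≡id)) (List.map-id x)
    where
    rank≡id : ∀ {v} → v ∈ x → rank x v ≡ v
    rank≡id {v} v∈ = begin
      rank x v          ≡⟨ rank-resp-↭ v x-perm ⟩
      rank (oneTo n) v  ≡⟨ rank-oneTo n v ⟩
      n ⊓ v             ≡⟨ m≥n⇒m⊓n≡n (proj₂ (∈-isPerm⁻ v∈)) ⟩
      v                 ∎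
      where open ≡-Reasoning

min-∈ : ∀ x l → min x l ∈ x ∷ l
min-∈ x l with argmin-sel id x l
... | inj₁ μ≡x = here μ≡x
... | inj₂ μ∈l = there μ∈l

st-∷-min : ∀ {v l} → All (v <_) l → st (v ∷ l) ≡ 1 ∷ map suc (st l)
st-∷-min {v} {l} v<l = cong₂ _∷_ rank-v (begin
  map (rank (v ∷ l)) l  ≡⟨ List.map-cong-local (All.map (rank-∷-≤ l ∘ <⇒≤) v<l) ⟩
  map (suc ∘ rank l) l  ≡⟨ List.map-∘ l ⟩
  map suc (st l)        ∎)
  where
  open ≡-Reasoning
  rank-v : rank (v ∷ l) v ≡ 1
  rank-v = trans (rank-∷-≤ l ≤-refl) (cong (suc ∘ length) (List.filter-none (_≤? v) (All.map <⇒≱ v<l)))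

st-isPerm : ∀ n {l} → length l ≡ n → Unique l → IsPerm n (st l)
st-isPerm zero {[]} _ _ = ↭-refl
st-isPerm (suc n) {x ∷ l₀} length-l u with ys , zs , eq ← ∈-∃++ (min-∈ x l₀) = begin
  st (x ∷ l₀)            ↭⟨ st-↭ l↭μ∷l′ ⟩
  st (μ ∷ l′)            ≡⟨ st-∷-min μ<l′ ⟩
  1 ∷ map suc (st l′)    ↭⟨ prep 1 (↭.map⁺ suc (st-isPerm n length-l′ unique-l′)) ⟩
  1 ∷ map suc (oneTo n)  ≡⟨ oneTo-suc n ⟨
  oneTo (suc n)          ∎
  where
  open PermutationReasoning
  μ : ℕ
  μ = min x l₀
  l′ : List ℕ
  l′ = ys ++ zs
  l↭μ∷l′ : x ∷ l₀ ↭ μ ∷ l′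
  l↭μ∷l′ = subst (_↭ μ ∷ l′) (sym eq) (↭.shift μ ys zs)
  unique-μ∷l′ : Unique (μ ∷ l′)
  unique-μ∷l′ = Unique-resp-↭ l↭μ∷l′ u
  unique-l′ : Unique l′
  unique-l′ with _ ∷ u′ ← unique-μ∷l′ = u′
  length-l′ : length l′ ≡ n
  length-l′ = suc-injective (trans (sym (↭.↭-length l↭μ∷l′)) length-l)
  μ≤ : ∀ {v} → v ∈ x ∷ l₀ → μ ≤ v
  μ≤ (here refl) = min≤⊤ x l₀
  μ≤ (there v∈) = All.lookup (min≤xs x l₀) v∈
  μ<l′ : All (μ <_) l′
  μ<l′ with μ∉ ∷ _ ← unique-μ∷l′ =
    All.tabulate λ v∈ → ≤∧≢⇒< (μ≤ (↭.∈-resp-↭ (↭-sym l↭μ∷l′) (there v∈))) (All.lookup μ∉ v∈)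

-- Walks in G(n)

PatternPeriod : ℕ → ℕ → List ℕ → Set
PatternPeriod n k x = st (take (n ∸ k) x) ≡ st (drop k x)

infixr 5 _◅_ _◅◅_

data Walk (n : ℕ) : ℕ → List ℕ → List ℕ → Set where
  ε : ∀ {a} → Walk n 0 a a
  _◅_ : ∀ {j a b c} → Edge n a b → Walk n j b c → Walk n (suc j) a c

_◅◅_ : ∀ {n i j a b c} → Walk n i a b → Walk n j b c → Walk n (i + j) a c
ε ◅◅ w = w
(e ◅ v) ◅◅ w = e ◅ (v ◅◅ w)

edge-overlap : ∀ {n a b} → Edge n a b → st (drop 1 a) ≡ st (take (n ∸ 1) b)
edge-overlap {n} (c , _ , refl , refl) = begin
  st (drop 1 (st (take n c)))        ≡⟨ st-drop 1 (take n c) ⟩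
  st (drop 1 (take n c))             ≡⟨ cong st (drop-take 1 n c) ⟩
  st (take (n ∸ 1) (drop 1 c))       ≡⟨ st-take (n ∸ 1) (drop 1 c) ⟨
  st (take (n ∸ 1) (st (drop 1 c)))  ∎
  where open ≡-Reasoning

walk-overlap : ∀ {n j a c} → length c ≡ n → Walk n j a c → st (drop j a) ≡ st (take (n ∸ j) c)
walk-overlap {n} {c = c} length-c ε = cong st (sym (List.take-all n c (≤-reflexive length-c)))
walk-overlap {n} {suc j} {a} {c} length-c (_◅_ {b = b} e w) = begin
  st (drop (suc j) a)                     ≡⟨ cong st (List.drop-drop 1 j a) ⟨
  st (drop j (drop 1 a))                  ≡⟨ st-drop-cong j (edge-overlap e) ⟩
  st (drop j (take (n ∸ 1) b))            ≡⟨ cong st (drop-take j (n ∸ 1) b) ⟩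
  st (take (n ∸ 1 ∸ j) (drop j b))        ≡⟨ st-take-cong (n ∸ 1 ∸ j) (walk-overlap length-c w) ⟩
  st (take (n ∸ 1 ∸ j) (take (n ∸ j) c))  ≡⟨ cong st (List.take-take (n ∸ 1 ∸ j) (n ∸ j) c) ⟩
  st (take ((n ∸ 1 ∸ j) ⊓ (n ∸ j)) c)     ≡⟨ cong (λ t → st (take t c)) shorter ⟩
  st (take (n ∸ suc j) c)                 ∎
  where
  open ≡-Reasoning
  shorter : (n ∸ 1 ∸ j) ⊓ (n ∸ j) ≡ n ∸ suc j
  shorter = trans (m≤n⇒m⊓n≡m (∸-monoˡ-≤ j (m∸n≤m n 1))) (∸-+-assoc n 1 j)

module _ {n k v} (cw : ClosedWalk n (suc k) v) where

  walk-from : ∀ i d → i + d ≤ k → Walk n d (v i) (v (i + d))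
  walk-from i zero _ rewrite +-identityʳ i = ε
  walk-from i (suc d) i+d≤k rewrite +-suc i d =
    proj₁ (proj₂ cw) i (s≤s (≤-trans (s≤s (m≤m+n i d)) i+d≤k)) ◅ walk-from (suc i) d i+d≤k

  closedWalk⇒cycle : ∀ {i} → i ≤ k → Walk n (suc k) (v i) (v i)
  closedWalk⇒cycle {i} i≤k =
    subst (λ j → Walk n j (v i) (v i)) length-cycle (to-last ◅◅ proj₂ (proj₂ cw) ◅ walk-from 0 i i≤k)
    where
    to-last : Walk n (k ∸ i) (v i) (v k)
    to-last = subst (λ j → Walk n (k ∸ i) (v i) (v j)) (m+[n∸m]≡n i≤k)
      (walk-from i (k ∸ i) (≤-reflexive (m+[n∸m]≡n i≤k)))
    length-cycle : k ∸ i + suc i ≡ suc k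
    length-cycle = trans (+-suc (k ∸ i) i) (cong suc (m∸n+n≡m i≤k))

onClosedWalk⇒patternPeriod : ∀ {n k x} → IsPerm n x → OnClosedWalk n k x → PatternPeriod n k x
onClosedWalk⇒patternPeriod {k = zero} _ (_ , _ , _ , () , _)
onClosedWalk⇒patternPeriod {k = suc k} x-perm (v , cw , i , s≤s i≤k , refl) =
  sym (walk-overlap (isPerm⇒length x-perm) (closedWalk⇒cycle cw i≤k))

window : ℕ → List ℕ → ℕ → List ℕ
window n s j = st (take n (drop j s))

module _ {n k : ℕ} {s : List ℕ} (s-unique : Unique s) (length-s : length s ≡ n + k) where

  private
    unique-segment : ∀ j t → Unique (take t (drop j s))
    unique-segment j t = Unique.take⁺ t (Unique.drop⁺ j s-unique)

    length-segment : ∀ j t → j + t ≤ n + k → length (take t (drop j s)) ≡ t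
    length-segment j t j+t≤ = length-take-≤ t (begin
      t                    ≤⟨ m+n≤o⇒m≤o∸n t (subst (_≤ n + k) (+-comm j t) j+t≤) ⟩
      n + k ∸ j            ≡⟨ cong (_∸ j) length-s ⟨
      length s ∸ j         ≡⟨ List.length-drop j s ⟨
      length (drop j s)    ∎)
      where open ≤-Reasoning

  window-isPerm : ∀ {j} → j ≤ k → IsPerm n (window n s j)
  window-isPerm {j} j≤k =
    st-isPerm n (length-segment j n (subst (_≤ n + k) (+-comm n j) (+-monoʳ-≤ n j≤k))) (unique-segment j n)

  window-edge : ∀ {j} → suc j ≤ k → Edge n (window n s j) (window n s (suc j))
  window-edge {j} j<k =
    st segment ,
    st-isPerm (suc n) (length-segment j (suc n) fits) (unique-segment j (suc n)) ,
    trans (st-take n segment) (cong st take-n-segment) ,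
    trans (st-drop 1 segment) (cong st drop-1-segment)
    where
    segment : List ℕ
    segment = take (suc n) (drop j s)
    fits : j + suc n ≤ n + k
    fits = subst (_≤ n + k) (trans (+-comm n (suc j)) (sym (+-suc j n))) (+-monoʳ-≤ n j<k)
    take-n-segment : take n segment ≡ take n (drop j s)
    take-n-segment = trans (List.take-take n (suc n) (drop j s))
                           (cong (λ t → take t (drop j s)) (m≤n⇒m⊓n≡m (n≤1+n n)))
    drop-1-segment : drop 1 segment ≡ take n (drop (suc j) s)
    drop-1-segment = begin
      drop 1 (take (suc n) (drop j s))  ≡⟨ drop-take 1 (suc n) (drop j s) ⟩
      take n (drop 1 (drop j s))        ≡⟨ cong (take n) (List.drop-drop j 1 s) ⟩
      take n (drop (j + 1) s)           ≡⟨ cong (λ t → take n (drop t s)) (+-comm j 1) ⟩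
      take n (drop (suc j) s)           ∎
      where open ≡-Reasoning

  windows-closedWalk : 1 ≤ k → window n s k ≡ window n s 0 → ClosedWalk n k (window n s)
  windows-closedWalk 1≤k wrap =
    (λ _ i<k → window-isPerm (<⇒≤ i<k)) ,
    (λ _ i+1<k → window-edge (<⇒≤ i+1<k)) ,
    subst (Edge n (window n s (k ∸ 1))) (trans (cong (window n s) k∸1+1≡k) wrap) (window-edge (≤-reflexive k∸1+1≡k))
    where
    k∸1+1≡k : suc (k ∸ 1) ≡ k
    k∸1+1≡k = m+[n∸m]≡n 1≤k

-- Building a closed walk through a vertex

module Interpolation (P : List (ℕ × ℕ))
  (iso : ∀ {p q} → p ∈ P → q ∈ P → proj₁ p ≤ proj₁ q ⇔ proj₂ p ≤ proj₂ q) where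

  below : ℕ → List ℕ
  below v = map proj₂ (filter (λ p → proj₁ p ≤? v) P)

  interp : ℕ → ℕ
  interp v = max 0 (below v)

  private
    ∈-below⁺ : ∀ {p v} → p ∈ P → proj₁ p ≤ v → proj₂ p ∈ below v
    ∈-below⁺ {v = v} p∈ le = ∈-map⁺ proj₂ (∈-filter⁺ (λ p → proj₁ p ≤? v) p∈ le)

    All-below : ∀ {Q : ℕ → Set} {v} → (∀ {p} → p ∈ P → proj₁ p ≤ v → Q (proj₂ p)) → All Q (below v)
    All-below {v = v} h = All.map⁺ (All.tabulate λ p∈ →
      let p∈P , le = ∈-filter⁻ (λ p → proj₁ p ≤? v) {xs = P} p∈ in h p∈P le)

  interp-mono : ∀ {u v} → u ≤ v → interp u ≤ interp v
  interp-mono u≤v = max-mono-⊆ ≤-refl (All.lookup (All-below λ p∈ le → ∈-below⁺ p∈ (≤-trans le u≤v)))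

  interp-at : ∀ {p} → p ∈ P → interp (proj₁ p) ≡ proj₂ p
  interp-at p∈ = max≈v⁺ (∈-below⁺ p∈ ≤-refl) (All-below λ q∈ le → to (iso q∈ p∈) le) z≤n

  interp-< : ∀ {p u} → p ∈ P → 0 < proj₂ p → u < proj₁ p → interp u < proj₂ p
  interp-< p∈ 0<p₂ u<p₁ = max<v⁺ 0<p₂ (All-below λ q∈ q₁≤u →
    ≰⇒> λ p₂≤q₂ → <⇒≱ (≤-<-trans q₁≤u u<p₁) (from (iso p∈ q∈) p₂≤q₂))

module Extension {n k x} (k≤n : k ≤ n) (x-perm : IsPerm n x) (period : PatternPeriod n k x) where

  private
    m N : ℕ
    m = n ∸ k
    N = suc n

    prefix suffix : List ℕ
    prefix = take m x
    suffix = drop k x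

    length-prefix≡suffix : length prefix ≡ length suffix
    length-prefix≡suffix = begin
      length (take m x)  ≡⟨ length-take-≤ m (subst (m ≤_) (sym (isPerm⇒length x-perm)) (m∸n≤m n k)) ⟩
      n ∸ k              ≡⟨ cong (_∸ k) (isPerm⇒length x-perm) ⟨
      length x ∸ k       ≡⟨ List.length-drop k x ⟨
      length (drop k x)  ∎
      where open ≡-Reasoning

    pairs : List (ℕ × ℕ)
    pairs = zip prefix suffix

    map-proj₁-pairs : map proj₁ pairs ≡ prefix
    map-proj₁-pairs = map-proj₁-zip prefix suffix length-prefix≡suffix

    map-proj₂-pairs : map proj₂ pairs ≡ suffix
    map-proj₂-pairs = map-proj₂-zip prefix suffix length-prefix≡suffix

    pairs-iso : ∀ {p q} → p ∈ pairs → q ∈ pairs → proj₁ p ≤ proj₁ q ⇔ proj₂ p ≤ proj₂ q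
    pairs-iso = st-≡⇒≤⇔ (trans (cong st map-proj₁-pairs) (trans period (cong st (sym map-proj₂-pairs))))

    open Interpolation pairs pairs-iso

    offset : ℕ → ℕ
    offset v with v ∈? prefix
    ... | yes _ = 0
    ... | no _ = v

    offset-≤ : ∀ v → offset v ≤ v
    offset-≤ v with v ∈? prefix
    ... | yes _ = z≤n
    ... | no _ = ≤-refl

    offset-∈ : ∀ {v} → v ∈ prefix → offset v ≡ 0
    offset-∈ {v} v∈ with v ∈? prefix
    ... | yes _ = refl
    ... | no v∉ = ⊥-elim (v∉ v∈)

    offset-∉ : ∀ {v} → v ∉ prefix → offset v ≡ v
    offset-∉ {v} v∉ with v ∈? prefix
    ... | yes v∈ = ⊥-elim (v∉ v∈)
    ... | no _ = refl

    ψ : ℕ → ℕ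
    ψ v = offset v + interp v * N

    ψ-pairs : ∀ {p} → p ∈ pairs → ψ (proj₁ p) ≡ proj₂ p * N
    ψ-pairs p∈ = cong₂ _+_ (offset-∈ (subst (_ ∈_) map-proj₁-pairs (∈-map⁺ proj₁ p∈)))
                           (cong (_* N) (interp-at p∈))

    interp-step : ∀ {u v} → u < v → v ∈ prefix → interp u < interp v
    interp-step u<v v∈
      with p , p∈ , refl ← ∈-map⁻ proj₁ (subst (_ ∈_) (sym map-proj₁-pairs) v∈)
      rewrite interp-at p∈ =
      interp-< p∈ (proj₁ (∈-isPerm⁻ x-perm (∈-drop⁻ k p₂∈suffix))) u<v
      where
      p₂∈suffix : proj₂ p ∈ suffix
      p₂∈suffix = subst (_ ∈_) map-proj₂-pairs (∈-map⁺ proj₂ p∈)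

    ψ-strictMono : StrictlyMonotoneOn x ψ
    ψ-strictMono {u} {v} _ v∈ u<v = by-cases (v ∈? prefix)
      where
      open ≤-Reasoning
      u<N : u < N
      u<N = <-≤-trans u<v (m≤n⇒m≤1+n (proj₂ (∈-isPerm⁻ x-perm v∈)))
      by-cases : Dec (v ∈ prefix) → ψ u < ψ v
      by-cases (yes v∈prefix) = begin-strict
        offset u + interp u * N  ≤⟨ +-monoˡ-≤ (interp u * N) (offset-≤ u) ⟩
        u + interp u * N         <⟨ +-monoˡ-< (interp u * N) u<N ⟩
        suc (interp u) * N       ≤⟨ *-monoˡ-≤ N (interp-step u<v v∈prefix) ⟩
        interp v * N             ≤⟨ m≤n+m (interp v * N) (offset v) ⟩
        ψ v                      ∎
      by-cases (no v∉prefix) = begin-strict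
        offset u + interp u * N  ≤⟨ +-monoˡ-≤ (interp u * N) (offset-≤ u) ⟩
        u + interp u * N         <⟨ +-monoˡ-< (interp u * N) u<v ⟩
        v + interp u * N         ≤⟨ +-monoʳ-≤ v (*-monoˡ-≤ N (interp-mono (<⇒≤ u<v))) ⟩
        v + interp v * N         ≡⟨ cong (_+ interp v * N) (offset-∉ v∉prefix) ⟨
        ψ v                      ∎

    ψ-mod : ∀ {v} → v ≤ n → ψ v % N ≡ offset v
    ψ-mod {v} v≤n = trans ([m+kn]%n≡m%n (offset v) (interp v) N) (m<n⇒m%n≡m (s≤s (≤-trans (offset-≤ v) v≤n)))

    map-ψ-prefix : map ψ prefix ≡ map (_* N) suffix
    map-ψ-prefix = begin
      map ψ prefix                  ≡⟨ cong (map ψ) map-proj₁-pairs ⟨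
      map ψ (map proj₁ pairs)       ≡⟨ List.map-∘ pairs ⟨
      map (ψ ∘ proj₁) pairs         ≡⟨ List.map-cong-local (All.tabulate ψ-pairs) ⟩
      map ((_* N) ∘ proj₂) pairs    ≡⟨ List.map-∘ pairs ⟩
      map (_* N) (map proj₂ pairs)  ≡⟨ cong (map (_* N)) map-proj₂-pairs ⟩
      map (_* N) suffix             ∎
      where open ≡-Reasoning

    scaled : List ℕ
    scaled = map (_* N) x

    length-scaled : length scaled ≡ n
    length-scaled = trans (List.length-map (_* N) x) (isPerm⇒length x-perm)

  sequence : List ℕ
  sequence = scaled ++ map ψ (drop m x)

  length-sequence : length sequence ≡ n + k
  length-sequence = begin
    length (scaled ++ map ψ (drop m x))       ≡⟨ List.length-++ scaled ⟩
    length scaled + length (map ψ (drop m x)) ≡⟨ cong₂ _+_ length-scaled (List.length-map ψ (drop m x)) ⟩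
    n + length (drop m x)                     ≡⟨ cong (n +_) (List.length-drop m x) ⟩
    n + (length x ∸ m)                        ≡⟨ cong (λ l → n + (l ∸ m)) (isPerm⇒length x-perm) ⟩
    n + (n ∸ m)                               ≡⟨ cong (n +_) (m∸[m∸n]≡n k≤n) ⟩
    n + k                                     ∎
    where open ≡-Reasoning

  sequence-unique : Unique sequence
  sequence-unique =
    Unique.++⁺ (Unique.map⁺ (*-cancelʳ-≡ _ _ N) x-unique)
               (Unique-map⁺-local ψ-injective (Unique.drop⁺ m x-unique))
               disjoint
    where
    x-unique : Unique x
    x-unique = isPerm⇒unique x-perm
    ψ-injective : ∀ {u v} → u ∈ drop m x → v ∈ drop m x → ψ u ≡ ψ v → u ≡ v
    ψ-injective u∈ v∈ = strictMono⇒injective ψ-strictMono (∈-drop⁻ m u∈) (∈-drop⁻ m v∈)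
    disjoint : Disjoint scaled (map ψ (drop m x))
    disjoint (w∈₁ , w∈₂) with a , _ , refl ← ∈-map⁻ (_* N) w∈₁ | b , b∈ , e ← ∈-map⁻ ψ w∈₂
      with 1≤b , b≤n ← ∈-isPerm⁻ x-perm (∈-drop⁻ m b∈) = <⇒≢ 1≤b (begin
        0          ≡⟨ m*n%n≡0 a N ⟨
        a * N % N  ≡⟨ cong (_% N) e ⟩
        ψ b % N    ≡⟨ ψ-mod b≤n ⟩
        offset b   ≡⟨ offset-∉ (λ b∈prefix → Unique⇒take-drop-disjoint m x-unique (b∈prefix , b∈)) ⟩
        b          ∎)
      where open ≡-Reasoning

  window-0 : window n sequence 0 ≡ x
  window-0 = begin
    st (take n (scaled ++ map ψ (drop m x)))  ≡⟨ cong (λ t → st (take t sequence)) length-scaled ⟨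
    st (take (length scaled) sequence)        ≡⟨ cong st (take-length-++ scaled) ⟩
    st (map (_* N) x)                         ≡⟨ st-map (λ _ _ → *-monoˡ-< N) ⟩
    st x                                      ≡⟨ st-isPerm-id x-perm ⟩
    x                                         ∎
    where open ≡-Reasoning

  window-k : window n sequence k ≡ x
  window-k = begin
    st (take n (drop k sequence))  ≡⟨ cong (st ∘ take n) drop-k ⟩
    st (take n (map ψ x))          ≡⟨ cong st (List.take-all n (map ψ x) (≤-reflexive length-ψx)) ⟩
    st (map ψ x)                   ≡⟨ st-map ψ-strictMono ⟩
    st x                           ≡⟨ st-isPerm-id x-perm ⟩
    x                              ∎
    where
    open ≡-Reasoning
    length-ψx : length (map ψ x) ≡ n
    length-ψx = trans (List.length-map ψ x) (isPerm⇒length x-perm)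
    drop-k : drop k sequence ≡ map ψ x
    drop-k = begin
      drop k (scaled ++ map ψ (drop m x))  ≡⟨ drop-++-≤ scaled (subst (k ≤_) (sym length-scaled) k≤n) ⟩
      drop k scaled ++ map ψ (drop m x)    ≡⟨ cong (_++ map ψ (drop m x)) (List.drop-map k x) ⟩
      map (_* N) suffix ++ map ψ (drop m x) ≡⟨ cong (_++ map ψ (drop m x)) map-ψ-prefix ⟨
      map ψ prefix ++ map ψ (drop m x)     ≡⟨ List.map-++ ψ prefix (drop m x) ⟨
      map ψ (prefix ++ drop m x)           ≡⟨ cong (map ψ) (List.take++drop≡id m x) ⟩
      map ψ x                              ∎

patternPeriod⇒onClosedWalk : ∀ {n k x} → 1 ≤ k → k ≤ n → IsPerm n x → PatternPeriod n k x → OnClosedWalk n k x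
patternPeriod⇒onClosedWalk {n} 1≤k k≤n x-perm period =
  window n sequence ,
  windows-closedWalk sequence-unique length-sequence 1≤k (trans window-k (sym window-0)) ,
  0 , 1≤k , window-0
  where open Extension k≤n x-perm period

onClosedWalk⇔patternPeriod : ∀ {n k x} → 1 ≤ k → k ≤ n →
  (IsPerm n x × OnClosedWalk n k x) ⇔ (IsPerm n x × PatternPeriod n k x)
onClosedWalk⇔patternPeriod 1≤k k≤n = mk⇔
  (λ (x-perm , on-walk) → x-perm , onClosedWalk⇒patternPeriod x-perm on-walk)
  (λ (x-perm , period) → x-perm , patternPeriod⇒onClosedWalk 1≤k k≤n x-perm period)

-- Counting

module Arrangements {A : Set} (_≟ᴬ_ : DecidableEquality A) where

  remove : List A → A → List A
  remove [] v = []
  remove (x ∷ xs) v with x ≟ᴬ v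
  ... | yes _ = xs
  ... | no _ = x ∷ remove xs v

  remove-↭ : ∀ {S v} → v ∈ S → v ∷ remove S v ↭ S
  remove-↭ {x ∷ S} {v} v∈ with x ≟ᴬ v | v∈
  ... | yes refl | _ = ↭-refl
  ... | no x≢v | here v≡x = ⊥-elim (x≢v (sym v≡x))
  ... | no _ | there v∈S = ↭-trans (swap v x ↭-refl) (prep x (remove-↭ v∈S))

  removeAll : List A → List A → List A
  removeAll S [] = S
  removeAll S (v ∷ a) = removeAll (remove S v) a

  arrangements : ℕ → List A → List (List A)
  arrangementsFrom : ℕ → List A → A → List (List A)

  arrangements zero S = [ [] ]
  arrangements (suc k) S = concatMap (arrangementsFrom k S) S

  arrangementsFrom k S v = map (v ∷_) (arrangements k (remove S v))

  ∈-arrangements⁻ : ∀ k S {a} → a ∈ arrangements k S → length a ≡ k × a ++ removeAll S a ↭ S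
  ∈-arrangements⁻ zero S (here refl) = refl , ↭-refl
  ∈-arrangements⁻ (suc k) S a∈
    with v , v∈ , a∈′ ← find (∈-concatMap⁻ (arrangementsFrom k S) {xs = S} a∈)
    with a′ , a′∈ , refl ← ∈-map⁻ (v ∷_) a∈′
    with length-a′ , a′↭ ← ∈-arrangements⁻ k (remove S v) a′∈ =
    cong suc length-a′ , ↭-trans (prep v a′↭) (remove-↭ v∈)

  ∈-arrangements⁺ : ∀ a {S b} → a ++ b ↭ S → a ∈ arrangements (length a) S × b ↭ removeAll S a
  ∈-arrangements⁺ [] p = here refl , p
  ∈-arrangements⁺ (v ∷ a) {S} p
    with v∈ ← ↭.∈-resp-↭ p (here refl)
    with a∈ , b↭ ← ∈-arrangements⁺ a (↭.drop-∷ (↭-trans p (↭-sym (remove-↭ v∈)))) =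
    ∈-concatMap⁺ (arrangementsFrom (length a) S) (lose v∈ (∈-map⁺ (v ∷_) a∈)) , b↭

  arrangements-unique : ∀ k {S} → Unique S → Unique (arrangements k S)
  arrangements-unique zero u = [] ∷ []
  arrangements-unique (suc k) {S} u = Unique.concat⁺
    (All.map⁺ (All.tabulate λ v∈ →
      Unique.map⁺ (proj₂ ∘ List.∷-injective) (arrangements-unique k (unique-remove v∈))))
    (AllPairs.map⁺ (AllPairs.map distinct-heads u))
    where
    unique-remove : ∀ {v} → v ∈ S → Unique (remove S v)
    unique-remove v∈ with _ ∷ u′ ← Unique-resp-↭ (↭-sym (remove-↭ v∈)) u = u′
    distinct-heads : ∀ {v w} {X Y : List (List A)} → v ≢ w → Disjoint (map (v ∷_) X) (map (w ∷_) Y)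
    distinct-heads v≢w (a∈₁ , a∈₂)
      with _ , _ , refl ← ∈-map⁻ _ a∈₁ | _ , _ , e ← ∈-map⁻ _ a∈₂ = v≢w (proj₁ (List.∷-injective e))

  length-arrangements : ∀ k S → length (arrangements k S) ≡ length S P′ k
  length-arrangements zero S = refl
  length-arrangements (suc k) S =
    trans (length-concatMap-const (arrangementsFrom k S) S length-from) (P′-suc (length S))
    where
    length-from : ∀ {v} → v ∈ S → length (arrangementsFrom k S v) ≡ pred (length S) P′ k
    length-from {v} v∈ = begin
      length (map (v ∷_) (arrangements k (remove S v)))  ≡⟨ List.length-map (v ∷_) (arrangements k (remove S v)) ⟩
      length (arrangements k (remove S v))               ≡⟨ length-arrangements k (remove S v) ⟩
      length (remove S v) P′ k                           ≡⟨ cong (λ l → pred l P′ k) (↭.↭-length (remove-↭ v∈)) ⟩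
      pred (length S) P′ k                               ∎
      where open ≡-Reasoning
    P′-suc : ∀ n → n * (pred n P′ k) ≡ n P′ suc k
    P′-suc zero = sym (cong (_* (0 P′ k)) (0∸n≡0 k))
    P′-suc (suc n) = sym (nP′k≡n[n∸1P′k∸1] (suc n) (suc k))

module Completion {n k : ℕ} (k≤n : k ≤ n) (n∸k≤k : n ∸ k ≤ k) where

  open Arrangements _≟_

  private
    m : ℕ
    m = n ∸ k

  completion-tail : List ℕ → List ℕ
  completion-tail a = map (unrank (removeAll (oneTo n) a)) (st (take m a))

  complete : List ℕ → List ℕ
  complete a = a ++ completion-tail a

  completions : List (List ℕ)
  completions = map complete (arrangements k (oneTo n))

  private
    take-complete : ∀ {a} → length a ≡ k → take k (complete a) ≡ a
    take-complete {a} refl = take-length-++ a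

    take-m-complete : ∀ {a} → length a ≡ k → take m (complete a) ≡ take m a
    take-m-complete {a} length-a = begin
      take m (complete a)           ≡⟨ cong (λ t → take t (complete a)) (m≤n⇒m⊓n≡m n∸k≤k) ⟨
      take (m ⊓ k) (complete a)     ≡⟨ List.take-take m k (complete a) ⟨
      take m (take k (complete a))  ≡⟨ cong (take m) (take-complete length-a) ⟩
      take m a                      ∎
      where open ≡-Reasoning

    drop-complete : ∀ {a} → length a ≡ k → drop k (complete a) ≡ completion-tail a
    drop-complete {a} refl = trans (drop-++-≤ a ≤-refl) (cong (_++ completion-tail a) (List.drop-all (length a) a ≤-refl))

  completions-unique : Unique completions
  completions-unique = Unique-map⁺-local injective (arrangements-unique k (oneTo-unique n))
    where
    injective : ∀ {a b} → a ∈ arrangements k (oneTo n) → b ∈ arrangements k (oneTo n) →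
                complete a ≡ complete b → a ≡ b
    injective {a} {b} a∈ b∈ e = begin
      a                    ≡⟨ take-complete (proj₁ (∈-arrangements⁻ k (oneTo n) a∈)) ⟨
      take k (complete a)  ≡⟨ cong (take k) e ⟩
      take k (complete b)  ≡⟨ take-complete (proj₁ (∈-arrangements⁻ k (oneTo n) b∈)) ⟩
      b                    ∎
      where open ≡-Reasoning

  length-completions : length completions ≡ _/_ (n !) ((n ∸ k) !) {{(n ∸ k) !≢0}}
  length-completions = begin
    length completions                     ≡⟨ List.length-map complete (arrangements k (oneTo n)) ⟩
    length (arrangements k (oneTo n))      ≡⟨ length-arrangements k (oneTo n) ⟩
    length (oneTo n) P′ k                  ≡⟨ cong (_P′ k) (length-oneTo n) ⟩
    n P′ k                                 ≡⟨ nP′k≡n!/[n∸k]! k≤n ⟩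
    _/_ (n !) ((n ∸ k) !) {{(n ∸ k) !≢0}}  ∎
    where open ≡-Reasoning

  complete-sound : ∀ {a} → a ∈ arrangements k (oneTo n) → IsPerm n (complete a) × PatternPeriod n k (complete a)
  complete-sound {a} a∈ = ↭-trans (↭.++⁺ˡ a tail↭R) a++R↭ , period
    where
    R : List ℕ
    R = removeAll (oneTo n) a
    length-a : length a ≡ k
    length-a = proj₁ (∈-arrangements⁻ k (oneTo n) a∈)
    a++R↭ : a ++ R ↭ oneTo n
    a++R↭ = proj₂ (∈-arrangements⁻ k (oneTo n) a∈)
    unique-a×R : Unique a × Unique R
    unique-a×R = Unique-++⁻ a (isPerm⇒unique a++R↭)
    length-R : length R ≡ m
    length-R = begin
      length R                 ≡⟨ m+n∸m≡n k (length R) ⟨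
      k + length R ∸ k         ≡⟨ cong (λ l → l + length R ∸ k) length-a ⟨
      length a + length R ∸ k  ≡⟨ cong (_∸ k) (List.length-++ a) ⟨
      length (a ++ R) ∸ k      ≡⟨ cong (_∸ k) (isPerm⇒length a++R↭) ⟩
      n ∸ k                    ∎
      where open ≡-Reasoning
    pattern-perm : IsPerm m (st (take m a))
    pattern-perm = st-isPerm m (length-take-≤ m (subst (m ≤_) (sym length-a) n∸k≤k))
                               (Unique.take⁺ m (proj₁ unique-a×R))
    pattern↭st-R : st (take m a) ↭ st R
    pattern↭st-R = ↭-trans pattern-perm (↭-sym (st-isPerm m length-R (proj₂ unique-a×R)))
    tail↭R : completion-tail a ↭ R
    tail↭R = map-unrank-↭ pattern↭st-R
    unrank-strictMono-pattern : StrictlyMonotoneOn (st (take m a)) (unrank R)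
    unrank-strictMono-pattern r∈ r′∈ =
      unrank-strictMono R (↭.∈-resp-↭ pattern↭st-R r∈) (↭.∈-resp-↭ pattern↭st-R r′∈)
    period : PatternPeriod n k (complete a)
    period = begin
      st (take m (complete a))  ≡⟨ cong st (take-m-complete length-a) ⟩
      st (take m a)             ≡⟨ st-isPerm-id pattern-perm ⟨
      st (st (take m a))        ≡⟨ st-map unrank-strictMono-pattern ⟨
      st (completion-tail a)    ≡⟨ cong st (drop-complete length-a) ⟨
      st (drop k (complete a))  ∎
      where open ≡-Reasoning

  complete-take≡id : ∀ {x} → IsPerm n x → PatternPeriod n k x → complete (take k x) ≡ x
  complete-take≡id {x} x-perm period = begin
    a ++ map (unrank R) (st (take m a))  ≡⟨ cong (λ l → a ++ map (unrank R) (st l)) take-m-a ⟩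
    a ++ map (unrank R) (st (take m x))  ≡⟨ cong (λ l → a ++ map (unrank R) l) period ⟩
    a ++ map (unrank R) (st (drop k x))  ≡⟨ cong (a ++_) (map-unrank-st (proj₂ (∈-arrangements⁺ a a++b↭))) ⟩
    a ++ drop k x                        ≡⟨ List.take++drop≡id k x ⟩
    x                                    ∎
    where
    open ≡-Reasoning
    a R : List ℕ
    a = take k x
    R = removeAll (oneTo n) a
    take-m-a : take m a ≡ take m x
    take-m-a = trans (List.take-take m k x) (cong (λ t → take t x) (m≤n⇒m⊓n≡m n∸k≤k))
    a++b↭ : a ++ drop k x ↭ oneTo n
    a++b↭ = subst (_↭ oneTo n) (sym (List.take++drop≡id k x)) x-perm

  ∈-completions : ∀ {x} → x ∈ completions ⇔ (IsPerm n x × PatternPeriod n k x)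
  ∈-completions = mk⇔ sound exhaustive
    where
    sound : ∀ {x} → x ∈ completions → IsPerm n x × PatternPeriod n k x
    sound x∈ with a , a∈ , refl ← ∈-map⁻ complete x∈ = complete-sound a∈
    exhaustive : ∀ {x} → IsPerm n x × PatternPeriod n k x → x ∈ completions
    exhaustive {x} (x-perm , period) = subst (_∈ completions) (complete-take≡id x-perm period) (∈-map⁺ complete a∈)
      where
      length-a : length (take k x) ≡ k
      length-a = length-take-≤ k (subst (k ≤_) (sym (isPerm⇒length x-perm)) k≤n)
      a∈ : take k x ∈ arrangements k (oneTo n)
      a∈ = subst (λ j → take k x ∈ arrangements j (oneTo n)) length-a
        (proj₁ (∈-arrangements⁺ (take k x) (subst (_↭ oneTo n) (sym (List.take++drop≡id k x)) x-perm)))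

theorem5p1 : (n k : ℕ) → 2 ≤ k → suc k ≤ n → n ≤ 2 * k →
    Σ (List (List ℕ)) λ L →
    Unique L ×
    (∀ x → (x ∈ L) ⇔ (IsPerm n x × OnClosedWalk n k x)) ×
    length L ≡ _/_ (n !) ((n ∸ k) !) {{(n ∸ k) !≢0}}
theorem5p1 n k 2≤k k<n n≤2k =
  completions ,
  completions-unique ,
  (λ x → mk⇔ (from on-walk⇔period ∘ to ∈-completions) (from ∈-completions ∘ to on-walk⇔period)) ,
  length-completions
  where
  k≤n : k ≤ n
  k≤n = ≤-trans (n≤1+n k) k<n
  n∸k≤k : n ∸ k ≤ k
  n∸k≤k = ≤-trans (∸-monoˡ-≤ k n≤2k) (≤-reflexive (trans (m+n∸m≡n k (k + 0)) (+-identityʳ k)))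
  on-walk⇔period : ∀ {x} → (IsPerm n x × OnClosedWalk n k x) ⇔ (IsPerm n x × PatternPeriod n k x)
  on-walk⇔period = onClosedWalk⇔patternPeriod (≤-trans (n≤1+n 1) 2≤k) k≤n
  open Completion k≤n n∸k≤k
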